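{- Let $n,k$ be positive integers and let $\mathcal{P}(n,1,0)$ be the set of lattice paths with steps $(1,1)$ and $(1,-1)$ from $(0,0)$ to $(2n,0)$. Among the paths in $\mathcal{P}(n,1,0)$ with exactly $k$ descending runs, the number of paths with exactly $i$ up steps below the $x$-axis is independent of $i$ for $i=0,1,\dots,n$, and equals $\frac{1}{n+1}\binom{n+1}{k}\binom{n-1}{k-1}$.
   Context: A descending run of a path is a maximal consecutive sequence of down steps. An up step is below the $x$-axis if its initial vertex has negative $y$-coordinate. -}

module Defs where

open import Data.Nat using (ℕ; zero; suc; _+_)
open import Data.Integer using (ℤ; _<_) renaming (_+_ to _+ℤ_; _-_ to _-ℤ_)
import Data.Integer as ℤ
open import Data.List using (List; []; _∷_; map; _++_; length; filter)
open import Data.Product using (_×_)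
open import Relation.Binary.PropositionalEquality using (_≡_)
open import Relation.Nullary using (Dec; yes; no)
open import Relation.Nullary.Decidable using (_×-dec_)
import Data.Nat.Properties as ℕP
import Data.Integer.Properties as ℤP

-- A step of a lattice path: U = (1,1), D = (1,-1).
data Step : Set where
  U D : Step

Path : Set
Path = List Step

allPaths : ℕ → List Path
allPaths zero = [] ∷ []
allPaths (suc m) = map (U ∷_) (allPaths m) ++ map (D ∷_) (allPaths m)

heightFrom : ℤ → Path → ℤ
heightFrom h [] = h
heightFrom h (U ∷ s) = heightFrom (h +ℤ ℤ.1ℤ) s
heightFrom h (D ∷ s) = heightFrom (h -ℤ ℤ.1ℤ) s

-- Number of descending runs (maximal consecutive blocks of D steps):
-- count the D steps that are not immediately preceded by a D step.
descRunsAux : Step → Path → ℕ   -- first argument: previous step (U at the start)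
descRunsAux _ [] = zero
descRunsAux U (U ∷ s) = descRunsAux U s
descRunsAux U (D ∷ s) = suc (descRunsAux D s)
descRunsAux D (U ∷ s) = descRunsAux U s
descRunsAux D (D ∷ s) = descRunsAux D s

descRuns : Path → ℕ
descRuns = descRunsAux U

upsBelowFrom : ℤ → Path → ℕ
upsBelowFrom h [] = zero
upsBelowFrom h (U ∷ s) with h ℤP.<? ℤ.0ℤ
... | yes _ = suc (upsBelowFrom (h +ℤ ℤ.1ℤ) s)
... | no _  = upsBelowFrom (h +ℤ ℤ.1ℤ) s
upsBelowFrom h (D ∷ s) = upsBelowFrom (h -ℤ ℤ.1ℤ) s

upsBelow : Path → ℕ
upsBelow = upsBelowFrom ℤ.0ℤ

P : ℕ → List Path
P n = filter (λ p → heightFrom ℤ.0ℤ p ℤP.≟ ℤ.0ℤ) (allPaths (n + n))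

count : ℕ → ℕ → ℕ → ℕ
count n k i = length (filter (λ p → (descRuns p ℕP.≟ k) ×-dec (upsBelow p ℕP.≟ i)) (P n))

-- Write a path p with fewer than n up steps below the x-axis as X U Y, where U is its last up
-- step leaving the axis. The rotation Y U X keeps length, endpoint and descending runs (an up
-- step separates runs) and has exactly one more up step below the axis, the rotated U, which
-- now starts at height −1; rotating at the first up step from height −1 undoes it. So the
-- count is the same for every i ≤ n, and n + 1 times it is the number of paths with n up and
-- n down steps and k descending runs, which a Pascal recursion evaluates to C(n+1,k) C(n−1,k−1).

module Submission where

open import Defs
open import Data.Nat using (ℕ; zero; suc; _+_; _*_; _≤_; _<_; z≤n; s≤s; s≤s⁻¹; ⌊_/2⌋)
open import Data.Nat.Combinatorics using (_C_; nCk+nC[k+1]≡[n+1]C[k+1])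
open import Relation.Binary.PropositionalEquality
  using (_≡_; _≢_; refl; sym; trans; cong; cong₂; subst; subst₂; module ≡-Reasoning)

open import Data.Nat.Properties as ℕP
  using ( ≤-refl; ≤-trans; ≤-reflexive; ≤-antisym; m≤n⇒m≤1+n
        ; +-comm; +-identityʳ; *-zeroʳ; *-distribˡ-+; *-distribʳ-+)
open import Algebra.Properties.CommutativeSemigroup ℕP.+-commutativeSemigroup using (interchange)
open import Data.Integer as ℤ using (ℤ; +_; 0ℤ; 1ℤ)
  renaming (_+_ to _+ℤ_; _-_ to _-ℤ_; _≤_ to _≤ℤ_; _<_ to _<ℤ_)
import Data.Integer.Properties as ℤP
open import Data.Integer.Tactic.RingSolver using (solve-∀)
open import Algebra.Properties.AbelianGroup ℤP.+-0-abelianGroup using () renaming (∙-cancelʳ to +ℤ-cancelʳ)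
open import Data.List using (List; []; _∷_; map; _++_; length; filter)
open import Data.List.Properties
  using ( ∷-injectiveʳ; length-map; length-++; length-++-sucʳ; length-++-comm
        ; filter-++; filter-≐; filter-none)
open import Data.List.Membership.Propositional using (_∈_)
open import Data.List.Membership.Propositional.Properties
  using (∈-∃++; ∈-++⁻; ∈-++⁺ˡ; ∈-++⁺ʳ; ∈-map⁺; ∈-map⁻; ∈-filter⁺; ∈-filter⁻)
open import Data.List.Relation.Binary.Subset.Propositional using (_⊆_)
open import Data.List.Relation.Binary.Disjoint.Propositional using (Disjoint)
open import Data.List.Relation.Unary.Any using (here; there)
open import Data.List.Relation.Unary.All as All using (All; []; _∷_)
import Data.List.Relation.Unary.All.Properties as Allₚ
open import Data.List.Relation.Unary.Unique.Propositional using (Unique)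
open import Data.List.Relation.Unary.AllPairs using ([]; _∷_)
import Data.List.Relation.Unary.Unique.Propositional.Properties as Uniqueₚ
open import Data.Product using (_×_; _,_; map₁; map₂; ∃₂)
open import Data.Maybe as Maybe using (Maybe; just; nothing)
open import Data.Unit using (⊤; tt)
open import Data.Sum using (inj₁; inj₂)
open import Data.Empty using (⊥-elim)
open import Level using (0ℓ)
open import Function using (_∘_; id)
open import Relation.Nullary using (Dec; yes; no; does; ¬_)
open import Relation.Nullary.Decidable using (_×-dec_; dec-true; dec-false)
open import Data.Bool using (true; false; if_then_else_)
open import Relation.Unary using (Pred; Decidable)

private variable
  A B : Set

length-≤-⊆ : {xs ys : List A} → Unique xs → xs ⊆ ys → length xs ≤ length ys
length-≤-⊆ {xs = []} _ _ = z≤n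
length-≤-⊆ {xs = x ∷ xs} (x∉xs ∷ xs!) xs⊆ys with ∈-∃++ (xs⊆ys (here refl))
... | ys₁ , ys₂ , refl =
  ≤-trans (s≤s (length-≤-⊆ xs! xs⊆ys₁++ys₂)) (≤-reflexive (sym (length-++-sucʳ ys₁ x ys₂)))
  where
  xs⊆ys₁++ys₂ : xs ⊆ ys₁ ++ ys₂
  xs⊆ys₁++ys₂ y∈xs with ∈-++⁻ ys₁ (xs⊆ys (there y∈xs))
  ... | inj₁ y∈ys₁ = ∈-++⁺ˡ y∈ys₁
  ... | inj₂ (here refl) = ⊥-elim (All.lookup x∉xs y∈xs refl)
  ... | inj₂ (there y∈ys₂) = ∈-++⁺ʳ ys₁ y∈ys₂

map⁺-injectiveOn : (f : A → B) {xs : List A} → Unique xs →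
  (∀ {x y} → x ∈ xs → y ∈ xs → f x ≡ f y → x ≡ y) → Unique (map f xs)
map⁺-injectiveOn f {[]} _ _ = []
map⁺-injectiveOn f {x ∷ xs} (x∉xs ∷ xs!) inj =
  Allₚ.map⁺ (All.tabulate λ y∈xs fx≡fy → All.lookup x∉xs y∈xs (inj (here refl) (there y∈xs) fx≡fy))
  ∷ map⁺-injectiveOn f xs! λ x∈xs y∈xs → inj (there x∈xs) (there y∈xs)

module _ {P : Pred A 0ℓ} {Q : Pred B 0ℓ} (P? : Decidable P) (Q? : Decidable Q) where

  length-filter-≤-retraction : {xs : List A} {ys : List B} → Unique xs → (f : A → B) (g : B → A) →
    (∀ {x} → x ∈ xs → P x → f x ∈ ys × Q (f x) × g (f x) ≡ x) →
    length (filter P? xs) ≤ length (filter Q? ys)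
  length-filter-≤-retraction {xs} {ys} xs! f g retract = begin
    length (filter P? xs)
      ≡⟨ length-map f (filter P? xs) ⟨
    length (map f (filter P? xs))
      ≤⟨ length-≤-⊆ (map⁺-injectiveOn f (Uniqueₚ.filter⁺ P? xs!) f-inj) f[xs]⊆ys ⟩
    length (filter Q? ys) ∎
    where
    open ℕP.≤-Reasoning
    f-inj : ∀ {x y} → x ∈ filter P? xs → y ∈ filter P? xs → f x ≡ f y → x ≡ y
    f-inj x∈ y∈ fx≡fy with ∈-filter⁻ P? x∈ | ∈-filter⁻ P? y∈
    ... | x∈xs , Px | y∈xs , Py with retract x∈xs Px | retract y∈xs Py
    ... | _ , _ , gfx≡x | _ , _ , gfy≡y = trans (sym gfx≡x) (trans (cong g fx≡fy) gfy≡y)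
    f[xs]⊆ys : map f (filter P? xs) ⊆ filter Q? ys
    f[xs]⊆ys z∈ with ∈-map⁻ f z∈
    ... | x , x∈ , refl with ∈-filter⁻ P? x∈
    ... | x∈xs , Px with retract x∈xs Px
    ... | fx∈ys , Qfx , _ = ∈-filter⁺ Q? fx∈ys Qfx

length-filter-≡-inverses : {P : Pred A 0ℓ} {Q : Pred B 0ℓ} (P? : Decidable P) (Q? : Decidable Q)
  {xs : List A} {ys : List B} → Unique xs → Unique ys →
  (f : A → B) (g : B → A) →
  (∀ {x} → x ∈ xs → P x → f x ∈ ys × Q (f x) × g (f x) ≡ x) →
  (∀ {y} → y ∈ ys → Q y → g y ∈ xs × P (g y) × f (g y) ≡ y) →
  length (filter P? xs) ≡ length (filter Q? ys)
length-filter-≡-inverses P? Q? xs! ys! f g g∘f f∘g = ≤-antisym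
  (length-filter-≤-retraction P? Q? xs! f g g∘f)
  (length-filter-≤-retraction Q? P? ys! g f f∘g)

∑≤ : ℕ → (ℕ → ℕ) → ℕ
∑≤ zero f = f 0
∑≤ (suc N) f = ∑≤ N f + f (suc N)

∑≤-cong : ∀ N {f g : ℕ → ℕ} → (∀ {i} → i ≤ N → f i ≡ g i) → ∑≤ N f ≡ ∑≤ N g
∑≤-cong zero f≗g = f≗g z≤n
∑≤-cong (suc N) f≗g = cong₂ _+_ (∑≤-cong N (f≗g ∘ m≤n⇒m≤1+n)) (f≗g ≤-refl)

∑≤-const : ∀ N c → ∑≤ N (λ _ → c) ≡ suc N * c
∑≤-const zero c = sym (+-identityʳ c)
∑≤-const (suc N) c = trans (cong (_+ c) (∑≤-const N c)) (+-comm (suc N * c) c)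

∑≤-zero : ∀ N {f : ℕ → ℕ} → (∀ {i} → i ≤ N → f i ≡ 0) → ∑≤ N f ≡ 0
∑≤-zero N f≗0 = trans (∑≤-cong N f≗0) (trans (∑≤-const N 0) (*-zeroʳ (suc N)))

∑≤-distrib-+ : ∀ N (f g : ℕ → ℕ) → ∑≤ N (λ i → f i + g i) ≡ ∑≤ N f + ∑≤ N g
∑≤-distrib-+ zero f g = refl
∑≤-distrib-+ (suc N) f g =
  trans (cong (_+ (f (suc N) + g (suc N))) (∑≤-distrib-+ N f g))
        (interchange (∑≤ N f) (∑≤ N g) (f (suc N)) (g (suc N)))

indicator : {X : Set} → Dec X → ℕ
indicator X? = if does X? then 1 else 0

indicator-no : {X : Set} (X? : Dec X) → ¬ X → indicator X? ≡ 0
indicator-no X? ¬x = cong (λ b → if b then 1 else 0) (dec-false X? ¬x)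

indicator-yes : {X : Set} (X? : Dec X) → X → indicator X? ≡ 1
indicator-yes X? x = cong (λ b → if b then 1 else 0) (dec-true X? x)

length-filter-∷ : {P : Pred A 0ℓ} (P? : Decidable P) (x : A) (xs : List A) →
  length (filter P? (x ∷ xs)) ≡ indicator (P? x) + length (filter P? xs)
length-filter-∷ P? x xs with does (P? x)
... | true = refl
... | false = refl

∑≤-indicator : ∀ N {a} → a ≤ N → ∑≤ N (λ i → indicator (a ℕP.≟ i)) ≡ 1
∑≤-indicator zero z≤n = refl
∑≤-indicator (suc N) {a} a≤1+N with ℕP.m≤n⇒m<n∨m≡n a≤1+N
... | inj₁ a<1+N =
  cong₂ _+_ (∑≤-indicator N (s≤s⁻¹ a<1+N)) (indicator-no (a ℕP.≟ suc N) (ℕP.<⇒≢ a<1+N))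
... | inj₂ refl = cong₂ _+_
  (∑≤-zero N λ {i} i≤N → indicator-no (suc N ℕP.≟ i) λ { refl → ℕP.<-irrefl refl (s≤s i≤N) })
  (indicator-yes (suc N ℕP.≟ suc N) refl)

module _ {R : Pred A 0ℓ} (R? : Decidable R) (u : A → ℕ) where

  fibre : (i : ℕ) → Decidable (λ x → R x × u x ≡ i)
  fibre i x = R? x ×-dec (u x ℕP.≟ i)

  ∑≤-indicator-fibre : ∀ N {x} → u x ≤ N → ∑≤ N (λ i → indicator (fibre i x)) ≡ indicator (R? x)
  ∑≤-indicator-fibre N {x} ux≤N with R? x
  ... | yes _ = ∑≤-indicator N ux≤N
  ... | no _ = ∑≤-zero N λ _ → refl

  ∑≤-length-filter-fibres : ∀ N xs → All (λ x → u x ≤ N) xs →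
    ∑≤ N (λ i → length (filter (fibre i) xs)) ≡ length (filter R? xs)
  ∑≤-length-filter-fibres N [] [] = ∑≤-zero N λ _ → refl
  ∑≤-length-filter-fibres N (x ∷ xs) (ux≤N ∷ u[xs]≤N) = begin
    ∑≤ N (λ i → length (filter (fibre i) (x ∷ xs)))
      ≡⟨ ∑≤-cong N (λ {i} _ → length-filter-∷ (fibre i) x xs) ⟩
    ∑≤ N (λ i → indicator (fibre i x) + length (filter (fibre i) xs))
      ≡⟨ ∑≤-distrib-+ N _ _ ⟩
    ∑≤ N (λ i → indicator (fibre i x)) + ∑≤ N (λ i → length (filter (fibre i) xs))
      ≡⟨ cong₂ _+_ (∑≤-indicator-fibre N ux≤N) (∑≤-length-filter-fibres N xs u[xs]≤N) ⟩
    indicator (R? x) + length (filter R? xs)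
      ≡⟨ length-filter-∷ R? x xs ⟨
    length (filter R? (x ∷ xs)) ∎
    where open ≡-Reasoning

#U #D : Path → ℕ
#U [] = 0
#U (U ∷ p) = suc (#U p)
#U (D ∷ p) = #U p
#D [] = 0
#D (U ∷ p) = #D p
#D (D ∷ p) = suc (#D p)

length≡#U+#D : ∀ p → length p ≡ #U p + #D p
length≡#U+#D [] = refl
length≡#U+#D (U ∷ p) = cong suc (length≡#U+#D p)
length≡#U+#D (D ∷ p) = trans (cong suc (length≡#U+#D p)) (sym (ℕP.+-suc (#U p) (#D p)))

heightFrom+#D≡+#U : ∀ h p → heightFrom h p +ℤ + #D p ≡ h +ℤ + #U p
heightFrom+#D≡+#U h [] = refl
heightFrom+#D≡+#U h (U ∷ p) = trans (heightFrom+#D≡+#U (h +ℤ 1ℤ) p) (ℤP.+-assoc h 1ℤ (+ #U p))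
heightFrom+#D≡+#U h (D ∷ p) = begin
  heightFrom (h -ℤ 1ℤ) p +ℤ (1ℤ +ℤ + #D p) ≡⟨ shuffle (heightFrom (h -ℤ 1ℤ) p) (+ #D p) ⟩
  heightFrom (h -ℤ 1ℤ) p +ℤ + #D p +ℤ 1ℤ   ≡⟨ cong (_+ℤ 1ℤ) (heightFrom+#D≡+#U (h -ℤ 1ℤ) p) ⟩
  h -ℤ 1ℤ +ℤ + #U p +ℤ 1ℤ                  ≡⟨ cancel h (+ #U p) ⟩
  h +ℤ + #U p                              ∎
  where
  open ≡-Reasoning
  shuffle : ∀ a b → a +ℤ (1ℤ +ℤ b) ≡ a +ℤ b +ℤ 1ℤ
  shuffle = solve-∀
  cancel : ∀ a b → a -ℤ 1ℤ +ℤ b +ℤ 1ℤ ≡ a +ℤ b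
  cancel = solve-∀

heightFrom-++ : ∀ h xs ys → heightFrom h (xs ++ ys) ≡ heightFrom (heightFrom h xs) ys
heightFrom-++ h [] ys = refl
heightFrom-++ h (U ∷ xs) ys = heightFrom-++ (h +ℤ 1ℤ) xs ys
heightFrom-++ h (D ∷ xs) ys = heightFrom-++ (h -ℤ 1ℤ) xs ys

heightFrom-+ : ∀ h c p → heightFrom (h +ℤ c) p ≡ heightFrom h p +ℤ c
heightFrom-+ h c [] = refl
heightFrom-+ h c (U ∷ p) =
  trans (cong (λ h′ → heightFrom h′ p) (swap h c 1ℤ)) (heightFrom-+ (h +ℤ 1ℤ) c p)
  where
  swap : ∀ a b d → a +ℤ b +ℤ d ≡ a +ℤ d +ℤ b
  swap = solve-∀
heightFrom-+ h c (D ∷ p) =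
  trans (cong (λ h′ → heightFrom h′ p) (swap h c)) (heightFrom-+ (h -ℤ 1ℤ) c p)
  where
  swap : ∀ a b → a +ℤ b -ℤ 1ℤ ≡ a -ℤ 1ℤ +ℤ b
  swap = solve-∀

heightFrom0≡-1 : ∀ p → heightFrom 1ℤ p ≡ 0ℤ → heightFrom 0ℤ p ≡ ℤ.-1ℤ
heightFrom0≡-1 p height≡0 = begin
  heightFrom 0ℤ p                 ≡⟨ +1-1 (heightFrom 0ℤ p) ⟨
  heightFrom 0ℤ p +ℤ 1ℤ -ℤ 1ℤ     ≡⟨ cong (_-ℤ 1ℤ) (heightFrom-+ 0ℤ 1ℤ p) ⟨
  heightFrom 1ℤ p -ℤ 1ℤ           ≡⟨ cong (_-ℤ 1ℤ) height≡0 ⟩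
  ℤ.-1ℤ                           ∎
  where
  open ≡-Reasoning
  +1-1 : ∀ a → a +ℤ 1ℤ -ℤ 1ℤ ≡ a
  +1-1 = solve-∀

upsBelowFrom-++ : ∀ h xs ys →
  upsBelowFrom h (xs ++ ys) ≡ upsBelowFrom h xs + upsBelowFrom (heightFrom h xs) ys
upsBelowFrom-++ h [] ys = refl
upsBelowFrom-++ h (U ∷ xs) ys with h ℤP.<? 0ℤ
... | yes _ = cong suc (upsBelowFrom-++ (h +ℤ 1ℤ) xs ys)
... | no _ = upsBelowFrom-++ (h +ℤ 1ℤ) xs ys
upsBelowFrom-++ h (D ∷ xs) ys = upsBelowFrom-++ (h -ℤ 1ℤ) xs ys

upsBelowFrom≤#U : ∀ h p → upsBelowFrom h p ≤ #U p
upsBelowFrom≤#U h [] = z≤n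
upsBelowFrom≤#U h (U ∷ p) with h ℤP.<? 0ℤ
... | yes _ = s≤s (upsBelowFrom≤#U (h +ℤ 1ℤ) p)
... | no _ = m≤n⇒m≤1+n (upsBelowFrom≤#U (h +ℤ 1ℤ) p)
upsBelowFrom≤#U h (D ∷ p) = upsBelowFrom≤#U (h -ℤ 1ℤ) p

runs≟ : (s : Step) (k : ℕ) → Decidable (λ p → descRunsAux s p ≡ k)
runs≟ s k p = descRunsAux s p ℕP.≟ k

descRunsAux-++-U : ∀ s xs ys → descRunsAux s (xs ++ U ∷ ys) ≡ descRunsAux s xs + descRuns ys
descRunsAux-++-U U [] ys = refl
descRunsAux-++-U D [] ys = refl
descRunsAux-++-U U (U ∷ xs) ys = descRunsAux-++-U U xs ys
descRunsAux-++-U U (D ∷ xs) ys = cong suc (descRunsAux-++-U D xs ys)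
descRunsAux-++-U D (U ∷ xs) ys = descRunsAux-++-U U xs ys
descRunsAux-++-U D (D ∷ xs) ys = descRunsAux-++-U D xs ys

descRuns-rotate : ∀ xs ys → descRuns (ys ++ U ∷ xs) ≡ descRuns (xs ++ U ∷ ys)
descRuns-rotate xs ys = begin
  descRuns (ys ++ U ∷ xs)     ≡⟨ descRunsAux-++-U U ys xs ⟩
  descRuns ys + descRuns xs   ≡⟨ +-comm (descRuns ys) (descRuns xs) ⟩
  descRuns xs + descRuns ys   ≡⟨ descRunsAux-++-U U xs ys ⟨
  descRuns (xs ++ U ∷ ys)     ∎
  where open ≡-Reasoning

length-rotate : ∀ xs ys → length (ys ++ U ∷ xs) ≡ length (xs ++ U ∷ ys)
length-rotate xs ys = begin
  length (ys ++ U ∷ xs)      ≡⟨ length-++-sucʳ ys U xs ⟩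
  suc (length (ys ++ xs))    ≡⟨ cong suc (length-++-comm ys xs) ⟩
  suc (length (xs ++ ys))    ≡⟨ length-++-sucʳ xs U ys ⟨
  length (xs ++ U ∷ ys)      ∎
  where open ≡-Reasoning

-1+1≡+1-1 : ∀ h → h -ℤ 1ℤ +ℤ 1ℤ ≡ h +ℤ 1ℤ -ℤ 1ℤ
-1+1≡+1-1 = solve-∀

module _ {h : ℤ} where

  <0⇒pred<0 : h <ℤ 0ℤ → h -ℤ 1ℤ <ℤ 0ℤ
  <0⇒pred<0 = ℤP.≤-<-trans (ℤP.i≤j⇒i-k≤j 1ℤ ℤP.≤-refl)

  ≤0⇒pred≤0 : h ≤ℤ 0ℤ → h -ℤ 1ℤ ≤ℤ 0ℤ
  ≤0⇒pred≤0 = ℤP.i≤j⇒i-k≤j 1ℤ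

  ≤0∧≢0⇒suc≤0 : h ≤ℤ 0ℤ → h ≢ 0ℤ → h +ℤ 1ℤ ≤ℤ 0ℤ
  ≤0∧≢0⇒suc≤0 h≤0 h≢0 =
    ℤP.≤-trans (ℤP.≤-reflexive (ℤP.+-comm h 1ℤ)) (ℤP.i<j⇒suc[i]≤j (ℤP.≤∧≢⇒< h≤0 h≢0))

  ≥0∧≢0⇒pred≥0 : 0ℤ ≤ℤ h → h ≢ 0ℤ → 0ℤ ≤ℤ h -ℤ 1ℤ
  ≥0∧≢0⇒pred≥0 0≤h h≢0 =
    ℤP.+-monoˡ-≤ (ℤ.- 1ℤ) (ℤP.i<j⇒suc[i]≤j (ℤP.≤∧≢⇒< 0≤h (h≢0 ∘ sym)))

-- Up steps leaving the x-axis and rotation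

NoUpAt0 : ℤ → Path → Set
NoUpAt0 h [] = ⊤
NoUpAt0 h (U ∷ p) = h ≢ 0ℤ × NoUpAt0 (h +ℤ 1ℤ) p
NoUpAt0 h (D ∷ p) = NoUpAt0 (h -ℤ 1ℤ) p

lastUpAt0 : ℤ → Path → Maybe (Path × Path)
lastUpAt0 h [] = nothing
lastUpAt0 h (U ∷ p) with lastUpAt0 (h +ℤ 1ℤ) p | h ℤP.≟ 0ℤ
... | just (xs , ys) | _ = just (U ∷ xs , ys)
... | nothing | yes _ = just ([] , p)
... | nothing | no _ = nothing
lastUpAt0 h (D ∷ p) = Maybe.map (map₁ (D ∷_)) (lastUpAt0 (h -ℤ 1ℤ) p)

firstUpAt0 : ℤ → Path → Maybe (Path × Path)
firstUpAt0 h [] = nothing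
firstUpAt0 h (U ∷ p) with h ℤP.≟ 0ℤ
... | yes _ = just ([] , p)
... | no _ = Maybe.map (map₁ (U ∷_)) (firstUpAt0 (h +ℤ 1ℤ) p)
firstUpAt0 h (D ∷ p) = Maybe.map (map₁ (D ∷_)) (firstUpAt0 (h -ℤ 1ℤ) p)

lastUpAt0-nothing : ∀ h p → lastUpAt0 h p ≡ nothing → NoUpAt0 h p
lastUpAt0-nothing h [] _ = tt
lastUpAt0-nothing h (U ∷ p) eq with lastUpAt0 (h +ℤ 1ℤ) p in eq′ | h ℤP.≟ 0ℤ
... | nothing | no h≢0 = h≢0 , lastUpAt0-nothing (h +ℤ 1ℤ) p eq′
lastUpAt0-nothing h (D ∷ p) eq with lastUpAt0 (h -ℤ 1ℤ) p in eq′
... | nothing = lastUpAt0-nothing (h -ℤ 1ℤ) p eq′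

NoUpAt0⇒lastUpAt0≡nothing : ∀ h p → NoUpAt0 h p → lastUpAt0 h p ≡ nothing
NoUpAt0⇒lastUpAt0≡nothing h [] _ = refl
NoUpAt0⇒lastUpAt0≡nothing h (U ∷ p) (h≢0 , noUp)
  rewrite NoUpAt0⇒lastUpAt0≡nothing (h +ℤ 1ℤ) p noUp with h ℤP.≟ 0ℤ
... | yes h≡0 = ⊥-elim (h≢0 h≡0)
... | no _ = refl
NoUpAt0⇒lastUpAt0≡nothing h (D ∷ p) noUp
  rewrite NoUpAt0⇒lastUpAt0≡nothing (h -ℤ 1ℤ) p noUp = refl

lastUpAt0-just : ∀ h p {xs ys} → lastUpAt0 h p ≡ just (xs , ys) →
  p ≡ xs ++ U ∷ ys × heightFrom h xs ≡ 0ℤ × NoUpAt0 (heightFrom h xs +ℤ 1ℤ) ys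
lastUpAt0-just h (U ∷ p) eq with lastUpAt0 (h +ℤ 1ℤ) p in eq′ | h ℤP.≟ 0ℤ
lastUpAt0-just h (U ∷ p) refl | just _ | _ with lastUpAt0-just (h +ℤ 1ℤ) p eq′
... | refl , height≡0 , noUp = refl , height≡0 , noUp
lastUpAt0-just h (U ∷ p) refl | nothing | yes refl = refl , refl , lastUpAt0-nothing (0ℤ +ℤ 1ℤ) p eq′
lastUpAt0-just h (D ∷ p) eq with lastUpAt0 (h -ℤ 1ℤ) p in eq′
lastUpAt0-just h (D ∷ p) refl | just _ with lastUpAt0-just (h -ℤ 1ℤ) p eq′
... | refl , height≡0 , noUp = refl , height≡0 , noUp

lastUpAt0-++ : ∀ h xs ys → heightFrom h xs ≡ 0ℤ → NoUpAt0 (heightFrom h xs +ℤ 1ℤ) ys →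
  lastUpAt0 h (xs ++ U ∷ ys) ≡ just (xs , ys)
lastUpAt0-++ h [] ys refl noUp rewrite NoUpAt0⇒lastUpAt0≡nothing (0ℤ +ℤ 1ℤ) ys noUp = refl
lastUpAt0-++ h (U ∷ xs) ys height≡0 noUp rewrite lastUpAt0-++ (h +ℤ 1ℤ) xs ys height≡0 noUp = refl
lastUpAt0-++ h (D ∷ xs) ys height≡0 noUp rewrite lastUpAt0-++ (h -ℤ 1ℤ) xs ys height≡0 noUp = refl

firstUpAt0-nothing : ∀ h p → firstUpAt0 h p ≡ nothing → NoUpAt0 h p
firstUpAt0-nothing h [] _ = tt
firstUpAt0-nothing h (U ∷ p) eq with h ℤP.≟ 0ℤ
... | no h≢0 with firstUpAt0 (h +ℤ 1ℤ) p in eq′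
...   | nothing = h≢0 , firstUpAt0-nothing (h +ℤ 1ℤ) p eq′
firstUpAt0-nothing h (D ∷ p) eq with firstUpAt0 (h -ℤ 1ℤ) p in eq′
... | nothing = firstUpAt0-nothing (h -ℤ 1ℤ) p eq′

firstUpAt0-just : ∀ h p {ys xs} → firstUpAt0 h p ≡ just (ys , xs) →
  p ≡ ys ++ U ∷ xs × heightFrom h ys ≡ 0ℤ × NoUpAt0 h ys
firstUpAt0-just h (U ∷ p) eq with h ℤP.≟ 0ℤ
firstUpAt0-just h (U ∷ p) refl | yes refl = refl , refl , tt
... | no h≢0 with firstUpAt0 (h +ℤ 1ℤ) p in eq′
firstUpAt0-just h (U ∷ p) refl | no h≢0 | just _ with firstUpAt0-just (h +ℤ 1ℤ) p eq′
... | refl , height≡0 , noUp = refl , height≡0 , h≢0 , noUp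
firstUpAt0-just h (D ∷ p) eq with firstUpAt0 (h -ℤ 1ℤ) p in eq′
firstUpAt0-just h (D ∷ p) refl | just _ with firstUpAt0-just (h -ℤ 1ℤ) p eq′
... | refl , height≡0 , noUp = refl , height≡0 , noUp

firstUpAt0-++ : ∀ h ys xs → heightFrom h ys ≡ 0ℤ → NoUpAt0 h ys →
  firstUpAt0 h (ys ++ U ∷ xs) ≡ just (ys , xs)
firstUpAt0-++ h [] xs refl _ = refl
firstUpAt0-++ h (U ∷ ys) xs height≡0 (h≢0 , noUp) with h ℤP.≟ 0ℤ
... | yes h≡0 = ⊥-elim (h≢0 h≡0)
... | no _ rewrite firstUpAt0-++ (h +ℤ 1ℤ) ys xs height≡0 noUp = refl
firstUpAt0-++ h (D ∷ ys) xs height≡0 noUp rewrite firstUpAt0-++ (h -ℤ 1ℤ) ys xs height≡0 noUp = refl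

upsBelowFrom-pred : ∀ h p → NoUpAt0 h p → upsBelowFrom (h -ℤ 1ℤ) p ≡ upsBelowFrom h p
upsBelowFrom-pred h [] _ = refl
upsBelowFrom-pred h (U ∷ p) (h≢0 , noUp) with h -ℤ 1ℤ ℤP.<? 0ℤ | h ℤP.<? 0ℤ
... | yes _ | yes _ =
  cong suc (trans (cong (λ h′ → upsBelowFrom h′ p) (-1+1≡+1-1 h)) (upsBelowFrom-pred (h +ℤ 1ℤ) p noUp))
... | no _ | no _ =
  trans (cong (λ h′ → upsBelowFrom h′ p) (-1+1≡+1-1 h)) (upsBelowFrom-pred (h +ℤ 1ℤ) p noUp)
... | yes h-1<0 | no h≮0 = ⊥-elim (ℤP.<⇒≱ h-1<0 (≥0∧≢0⇒pred≥0 (ℤP.≮⇒≥ h≮0) h≢0))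
... | no h-1≮0 | yes h<0 = ⊥-elim (h-1≮0 (<0⇒pred<0 h<0))
upsBelowFrom-pred h (D ∷ p) noUp = upsBelowFrom-pred (h -ℤ 1ℤ) p noUp

heightFrom-≤0 : ∀ h p → h ≤ℤ 0ℤ → NoUpAt0 h p → heightFrom h p ≤ℤ 0ℤ
heightFrom-≤0 h [] h≤0 _ = h≤0
heightFrom-≤0 h (U ∷ p) h≤0 (h≢0 , noUp) = heightFrom-≤0 (h +ℤ 1ℤ) p (≤0∧≢0⇒suc≤0 h≤0 h≢0) noUp
heightFrom-≤0 h (D ∷ p) h≤0 noUp = heightFrom-≤0 (h -ℤ 1ℤ) p (≤0⇒pred≤0 h≤0) noUp

upsBelowFrom≡#U : ∀ h p → h ≤ℤ 0ℤ → NoUpAt0 h p → upsBelowFrom h p ≡ #U p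
upsBelowFrom≡#U h [] _ _ = refl
upsBelowFrom≡#U h (U ∷ p) h≤0 (h≢0 , noUp) with h ℤP.<? 0ℤ
... | yes _ = cong suc (upsBelowFrom≡#U (h +ℤ 1ℤ) p (≤0∧≢0⇒suc≤0 h≤0 h≢0) noUp)
... | no h≮0 = ⊥-elim (h≮0 (ℤP.≤∧≢⇒< h≤0 h≢0))
upsBelowFrom≡#U h (D ∷ p) h≤0 noUp = upsBelowFrom≡#U (h -ℤ 1ℤ) p (≤0⇒pred≤0 h≤0) noUp

upsBelowFrom≡0 : ∀ h p → 0ℤ ≤ℤ h → NoUpAt0 h p → 0ℤ <ℤ heightFrom h p → upsBelowFrom h p ≡ 0
upsBelowFrom≡0 h [] _ _ _ = refl
upsBelowFrom≡0 h (U ∷ p) 0≤h (h≢0 , noUp) 0<end with h ℤP.<? 0ℤ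
... | yes h<0 = ⊥-elim (ℤP.<⇒≱ h<0 0≤h)
... | no _ = upsBelowFrom≡0 (h +ℤ 1ℤ) p (ℤP.≤-trans 0≤h (ℤP.i≤i+j h 1ℤ)) noUp 0<end
upsBelowFrom≡0 h (D ∷ p) 0≤h noUp 0<end with h ℤP.≟ 0ℤ
... | yes refl = ⊥-elim (ℤP.<⇒≱ 0<end (heightFrom-≤0 (0ℤ -ℤ 1ℤ) p (≤0⇒pred≤0 ℤP.≤-refl) noUp))
... | no h≢0 = upsBelowFrom≡0 (h -ℤ 1ℤ) p (≥0∧≢0⇒pred≥0 0≤h h≢0) noUp 0<end

record AxisSplit (xs ys : Path) : Set where
  field
    height-xs : heightFrom 0ℤ xs ≡ 0ℤ
    height-ys : heightFrom 1ℤ ys ≡ 0ℤ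
    noUp-ys : NoUpAt0 1ℤ ys

rotateWith : Path → Maybe (Path × Path) → Path
rotateWith p nothing = p
rotateWith p (just (xs , ys)) = ys ++ U ∷ xs

-- lower reads q one unit higher, so it rotates at the first up step of q from height −1.
raise lower : Path → Path
raise p = rotateWith p (lastUpAt0 0ℤ p)
lower q = rotateWith q (firstUpAt0 1ℤ q)

module _ {xs ys : Path} (split : AxisSplit xs ys) where
  open AxisSplit split

  height-joined : heightFrom 0ℤ (xs ++ U ∷ ys) ≡ 0ℤ
  height-joined = begin
    heightFrom 0ℤ (xs ++ U ∷ ys)                  ≡⟨ heightFrom-++ 0ℤ xs (U ∷ ys) ⟩
    heightFrom (heightFrom 0ℤ xs +ℤ 1ℤ) ys         ≡⟨ cong (λ h → heightFrom (h +ℤ 1ℤ) ys) height-xs ⟩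
    heightFrom 1ℤ ys                              ≡⟨ height-ys ⟩
    0ℤ                                            ∎
    where open ≡-Reasoning

  height-rotated : heightFrom 0ℤ (ys ++ U ∷ xs) ≡ 0ℤ
  height-rotated = begin
    heightFrom 0ℤ (ys ++ U ∷ xs)
      ≡⟨ heightFrom-++ 0ℤ ys (U ∷ xs) ⟩
    heightFrom (heightFrom 0ℤ ys +ℤ 1ℤ) xs
      ≡⟨ cong (λ h → heightFrom (h +ℤ 1ℤ) xs) (heightFrom0≡-1 ys height-ys) ⟩
    heightFrom 0ℤ xs
      ≡⟨ height-xs ⟩
    0ℤ ∎
    where open ≡-Reasoning

  -- The rotated up step starts at height −1, every other up step keeps its status.
  upsBelow-rotated : upsBelow (ys ++ U ∷ xs) ≡ suc (upsBelow (xs ++ U ∷ ys))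
  upsBelow-rotated = begin
    upsBelow (ys ++ U ∷ xs)
      ≡⟨ upsBelowFrom-++ 0ℤ ys (U ∷ xs) ⟩
    upsBelow ys + upsBelowFrom (heightFrom 0ℤ ys) (U ∷ xs)
      ≡⟨ cong (λ h → upsBelow ys + upsBelowFrom h (U ∷ xs)) (heightFrom0≡-1 ys height-ys) ⟩
    upsBelow ys + suc (upsBelow xs)
      ≡⟨ ℕP.+-suc (upsBelow ys) (upsBelow xs) ⟩
    suc (upsBelow ys + upsBelow xs)
      ≡⟨ cong suc (+-comm (upsBelow ys) (upsBelow xs)) ⟩
    suc (upsBelow xs + upsBelow ys)
      ≡⟨ cong (λ n → suc (upsBelow xs + n)) (upsBelowFrom-pred 1ℤ ys noUp-ys) ⟩
    suc (upsBelow xs + upsBelowFrom 0ℤ (U ∷ ys))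
      ≡⟨ cong (λ h → suc (upsBelow xs + upsBelowFrom h (U ∷ ys))) height-xs ⟨
    suc (upsBelow xs + upsBelowFrom (heightFrom 0ℤ xs) (U ∷ ys))
      ≡⟨ cong suc (upsBelowFrom-++ 0ℤ xs (U ∷ ys)) ⟨
    suc (upsBelow (xs ++ U ∷ ys)) ∎
    where open ≡-Reasoning

  raise-joined : raise (xs ++ U ∷ ys) ≡ ys ++ U ∷ xs
  raise-joined = cong (rotateWith (xs ++ U ∷ ys))
    (lastUpAt0-++ 0ℤ xs ys height-xs (subst (λ h → NoUpAt0 (h +ℤ 1ℤ) ys) (sym height-xs) noUp-ys))

  lower-rotated : lower (ys ++ U ∷ xs) ≡ xs ++ U ∷ ys
  lower-rotated = cong (rotateWith (ys ++ U ∷ xs)) (firstUpAt0-++ 1ℤ ys xs height-ys noUp-ys)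

split-at-lastUpAt0 : ∀ p → heightFrom 0ℤ p ≡ 0ℤ → upsBelow p < #U p →
  ∃₂ λ xs ys → p ≡ xs ++ U ∷ ys × AxisSplit xs ys
split-at-lastUpAt0 p height≡0 ups<#U with lastUpAt0 0ℤ p in eq
... | nothing = ⊥-elim (ℕP.<⇒≢ ups<#U (upsBelowFrom≡#U 0ℤ p ℤP.≤-refl (lastUpAt0-nothing 0ℤ p eq)))
... | just (xs , ys) with lastUpAt0-just 0ℤ p eq
... | refl , height-xs , noUp = xs , ys , refl , record
  { height-xs = height-xs
  ; height-ys = begin
      heightFrom 1ℤ ys                       ≡⟨ cong (λ h → heightFrom (h +ℤ 1ℤ) ys) height-xs ⟨
      heightFrom (heightFrom 0ℤ xs +ℤ 1ℤ) ys  ≡⟨ heightFrom-++ 0ℤ xs (U ∷ ys) ⟨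
      heightFrom 0ℤ (xs ++ U ∷ ys)           ≡⟨ height≡0 ⟩
      0ℤ                                     ∎
  ; noUp-ys = subst (λ h → NoUpAt0 (h +ℤ 1ℤ) ys) height-xs noUp
  }
  where open ≡-Reasoning

split-at-firstUpAt0 : ∀ q → heightFrom 0ℤ q ≡ 0ℤ → 0 < upsBelow q →
  ∃₂ λ xs ys → q ≡ ys ++ U ∷ xs × AxisSplit xs ys
split-at-firstUpAt0 q height≡0 0<ups with firstUpAt0 1ℤ q in eq
... | nothing = ⊥-elim (ℕP.<⇒≢ 0<ups (sym noneBelow))
  where
  -- Without an up step from height −1, q could not climb back once below the axis, yet it ends on it.
  noUp = firstUpAt0-nothing 1ℤ q eq
  noneBelow : upsBelow q ≡ 0
  noneBelow = trans (upsBelowFrom-pred 1ℤ q noUp)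
    (upsBelowFrom≡0 1ℤ q (ℤ.+≤+ z≤n) noUp
      (subst (0ℤ <ℤ_) (sym (trans (heightFrom-+ 0ℤ 1ℤ q) (cong (_+ℤ 1ℤ) height≡0))) (ℤ.+<+ (s≤s z≤n))))
... | just (ys , xs) with firstUpAt0-just 1ℤ q eq
... | refl , height-ys , noUp = xs , ys , refl , record
  { height-xs = begin
      heightFrom 0ℤ xs
        ≡⟨ cong (λ h → heightFrom (h +ℤ 1ℤ) xs) (heightFrom0≡-1 ys height-ys) ⟨
      heightFrom (heightFrom 0ℤ ys +ℤ 1ℤ) xs
        ≡⟨ heightFrom-++ 0ℤ ys (U ∷ xs) ⟨
      heightFrom 0ℤ (ys ++ U ∷ xs)
        ≡⟨ height≡0 ⟩
      0ℤ ∎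
  ; height-ys = height-ys
  ; noUp-ys = noUp
  }
  where open ≡-Reasoning

-- Paths from (0,0) to (2n,0) and the rotation bijection

Unique-branches : {xs ys : List Path} → Unique xs → Unique ys →
  Unique (map (U ∷_) xs ++ map (D ∷_) ys)
Unique-branches xs! ys! =
  Uniqueₚ.++⁺ (Uniqueₚ.map⁺ ∷-injectiveʳ xs!) (Uniqueₚ.map⁺ ∷-injectiveʳ ys!) disjoint
  where
  disjoint : Disjoint (map (U ∷_) _) (map (D ∷_) _)
  disjoint (u∈ , d∈) with ∈-map⁻ (U ∷_) u∈ | ∈-map⁻ (D ∷_) d∈
  ... | _ , _ , refl | _ , _ , ()

allPaths-unique : ∀ L → Unique (allPaths L)
allPaths-unique zero = [] ∷ []
allPaths-unique (suc L) = Unique-branches (allPaths-unique L) (allPaths-unique L)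

∈-allPaths : ∀ p → p ∈ allPaths (length p)
∈-allPaths [] = here refl
∈-allPaths (U ∷ p) = ∈-++⁺ˡ (∈-map⁺ (U ∷_) (∈-allPaths p))
∈-allPaths (D ∷ p) = ∈-++⁺ʳ (map (U ∷_) (allPaths (length p))) (∈-map⁺ (D ∷_) (∈-allPaths p))

∈-allPaths⇒length : ∀ {L p} → p ∈ allPaths L → length p ≡ L
∈-allPaths⇒length {zero} (here refl) = refl
∈-allPaths⇒length {suc L} p∈ with ∈-++⁻ (map (U ∷_) (allPaths L)) p∈
... | inj₁ p∈U with ∈-map⁻ (U ∷_) p∈U
...   | _ , p′∈ , refl = cong suc (∈-allPaths⇒length p′∈)
∈-allPaths⇒length {suc L} p∈ | inj₂ p∈D with ∈-map⁻ (D ∷_) p∈D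
...   | _ , p′∈ , refl = cong suc (∈-allPaths⇒length p′∈)

P-unique : ∀ n → Unique (P n)
P-unique n = Uniqueₚ.filter⁺ _ (allPaths-unique (n + n))

∈P⁺ : ∀ n {p} → length p ≡ n + n → heightFrom 0ℤ p ≡ 0ℤ → p ∈ P n
∈P⁺ n {p} length≡ =
  ∈-filter⁺ (λ p → heightFrom 0ℤ p ℤP.≟ 0ℤ) (subst (λ L → p ∈ allPaths L) length≡ (∈-allPaths p))

∈P⁻ : ∀ n {p} → p ∈ P n → length p ≡ n + n × heightFrom 0ℤ p ≡ 0ℤ
∈P⁻ n p∈ with ∈-filter⁻ (λ p → heightFrom 0ℤ p ℤP.≟ 0ℤ) p∈
... | p∈allPaths , height≡0 = ∈-allPaths⇒length p∈allPaths , height≡0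

#D≡#U : ∀ p → heightFrom 0ℤ p ≡ 0ℤ → #D p ≡ #U p
#D≡#U p height≡0 = ℤP.+-injective (begin
  + #D p                      ≡⟨ cong (_+ℤ + #D p) height≡0 ⟨
  heightFrom 0ℤ p +ℤ + #D p   ≡⟨ heightFrom+#D≡+#U 0ℤ p ⟩
  0ℤ +ℤ + #U p                ≡⟨ ℤP.+-identityˡ (+ #U p) ⟩
  + #U p                      ∎)
  where open ≡-Reasoning

#D≡#U⇒heightFrom0≡0 : ∀ p → #D p ≡ #U p → heightFrom 0ℤ p ≡ 0ℤ
#D≡#U⇒heightFrom0≡0 p #D≡#U = +ℤ-cancelʳ (+ #D p) (heightFrom 0ℤ p) 0ℤ (begin
  heightFrom 0ℤ p +ℤ + #D p   ≡⟨ heightFrom+#D≡+#U 0ℤ p ⟩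
  0ℤ +ℤ + #U p                ≡⟨ cong (λ d → 0ℤ +ℤ + d) #D≡#U ⟨
  0ℤ +ℤ + #D p                ∎)
  where open ≡-Reasoning

∈P⇒#U≡n : ∀ n {p} → p ∈ P n → #U p ≡ n
∈P⇒#U≡n n {p} p∈ with ∈P⁻ n p∈
... | length≡ , height≡0 = begin
  #U p                   ≡⟨ ℕP.n≡⌊n+n/2⌋ (#U p) ⟩
  ⌊ #U p + #U p /2⌋      ≡⟨ cong (λ d → ⌊ #U p + d /2⌋) (#D≡#U p height≡0) ⟨
  ⌊ #U p + #D p /2⌋      ≡⟨ cong ⌊_/2⌋ (trans (sym (length≡#U+#D p)) length≡) ⟩
  ⌊ n + n /2⌋            ≡⟨ ℕP.n≡⌊n+n/2⌋ n ⟨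
  n                      ∎
  where open ≡-Reasoning

module _ (n k : ℕ) where

  count-step : ∀ i → suc i ≤ n → count n k i ≡ count n k (suc i)
  count-step i i<n =
    length-filter-≡-inverses (fibre (runs≟ U k) upsBelow i) (fibre (runs≟ U k) upsBelow (suc i))
      (P-unique n) (P-unique n) raise lower forth back
    where
    forth : ∀ {p} → p ∈ P n → descRuns p ≡ k × upsBelow p ≡ i →
      raise p ∈ P n × (descRuns (raise p) ≡ k × upsBelow (raise p) ≡ suc i) × lower (raise p) ≡ p
    forth {p} p∈ (runs≡k , ups≡i) with ∈P⁻ n p∈
    ... | length≡ , height≡0
      with split-at-lastUpAt0 p height≡0 (subst₂ _<_ (sym ups≡i) (sym (∈P⇒#U≡n n p∈)) i<n)
    ... | xs , ys , refl , split rewrite raise-joined split =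
      ∈P⁺ n (trans (length-rotate xs ys) length≡) (height-rotated split) ,
      (trans (descRuns-rotate xs ys) runs≡k , trans (upsBelow-rotated split) (cong suc ups≡i)) ,
      lower-rotated split
    back : ∀ {q} → q ∈ P n → descRuns q ≡ k × upsBelow q ≡ suc i →
      lower q ∈ P n × (descRuns (lower q) ≡ k × upsBelow (lower q) ≡ i) × raise (lower q) ≡ q
    back {q} q∈ (runs≡k , ups≡1+i) with ∈P⁻ n q∈
    ... | length≡ , height≡0
      with split-at-firstUpAt0 q height≡0 (subst (0 <_) (sym ups≡1+i) (s≤s z≤n))
    ... | xs , ys , refl , split rewrite lower-rotated split =
      ∈P⁺ n (trans (sym (length-rotate xs ys)) length≡) (height-joined split) ,
      (trans (sym (descRuns-rotate xs ys)) runs≡k ,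
       ℕP.suc-injective (trans (sym (upsBelow-rotated split)) ups≡1+i)) ,
      raise-joined split

  count-uniform : ∀ {i} → i ≤ n → count n k i ≡ count n k 0
  count-uniform {zero} _ = refl
  count-uniform {suc i} i<n = trans (sym (count-step i i<n)) (count-uniform (ℕP.<⇒≤ i<n))

  ∑≤-count : ∑≤ n (count n k) ≡ length (filter (runs≟ U k) (P n))
  ∑≤-count = ∑≤-length-filter-fibres (runs≟ U k) upsBelow n (P n)
    (All.tabulate λ {p} p∈ → ≤-trans (upsBelowFrom≤#U 0ℤ p) (≤-reflexive (∈P⇒#U≡n n p∈)))

-- Counting paths by descending runs

words : ℕ → ℕ → List Path
words zero zero = [] ∷ []
words (suc a) zero = map (U ∷_) (words a zero)
words zero (suc b) = map (D ∷_) (words zero b)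
words (suc a) (suc b) = map (U ∷_) (words a (suc b)) ++ map (D ∷_) (words (suc a) b)

words-unique : ∀ a b → Unique (words a b)
words-unique zero zero = [] ∷ []
words-unique (suc a) zero = Uniqueₚ.map⁺ ∷-injectiveʳ (words-unique a zero)
words-unique zero (suc b) = Uniqueₚ.map⁺ ∷-injectiveʳ (words-unique zero b)
words-unique (suc a) (suc b) = Unique-branches (words-unique a (suc b)) (words-unique (suc a) b)

U∷-∈-words : ∀ a b {p} → p ∈ words a b → U ∷ p ∈ words (suc a) b
U∷-∈-words a zero p∈ = ∈-map⁺ (U ∷_) p∈
U∷-∈-words a (suc b) p∈ = ∈-++⁺ˡ (∈-map⁺ (U ∷_) p∈)

D∷-∈-words : ∀ a b {p} → p ∈ words a b → D ∷ p ∈ words a (suc b)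
D∷-∈-words zero b p∈ = ∈-map⁺ (D ∷_) p∈
D∷-∈-words (suc a) b p∈ = ∈-++⁺ʳ (map (U ∷_) (words a (suc b))) (∈-map⁺ (D ∷_) p∈)

∈-words : ∀ p → p ∈ words (#U p) (#D p)
∈-words [] = here refl
∈-words (U ∷ p) = U∷-∈-words (#U p) (#D p) (∈-words p)
∈-words (D ∷ p) = D∷-∈-words (#U p) (#D p) (∈-words p)

∈-words⇒#U,#D : ∀ a b {p} → p ∈ words a b → #U p ≡ a × #D p ≡ b
∈-words⇒#U,#D zero zero (here refl) = refl , refl
∈-words⇒#U,#D (suc a) zero p∈ with ∈-map⁻ (U ∷_) p∈
... | _ , p∈′ , refl = map₁ (cong suc) (∈-words⇒#U,#D a zero p∈′)
∈-words⇒#U,#D zero (suc b) p∈ with ∈-map⁻ (D ∷_) p∈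
... | _ , p∈′ , refl = map₂ (cong suc) (∈-words⇒#U,#D zero b p∈′)
∈-words⇒#U,#D (suc a) (suc b) p∈ with ∈-++⁻ (map (U ∷_) (words a (suc b))) p∈
... | inj₁ p∈U with ∈-map⁻ (U ∷_) p∈U
...   | _ , p∈′ , refl = map₁ (cong suc) (∈-words⇒#U,#D a (suc b) p∈′)
∈-words⇒#U,#D (suc a) (suc b) p∈ | inj₂ p∈D with ∈-map⁻ (D ∷_) p∈D
...   | _ , p∈′ , refl = map₂ (cong suc) (∈-words⇒#U,#D (suc a) b p∈′)

length-filter-map : {P : Pred B 0ℓ} (P? : Decidable P) (f : A → B) (xs : List A) →
  length (filter P? (map f xs)) ≡ length (filter (P? ∘ f) xs)
length-filter-map P? f [] = refl
length-filter-map P? f (x ∷ xs) = begin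
  length (filter P? (f x ∷ map f xs))
    ≡⟨ length-filter-∷ P? (f x) (map f xs) ⟩
  indicator (P? (f x)) + length (filter P? (map f xs))
    ≡⟨ cong (_+_ (indicator (P? (f x)))) (length-filter-map P? f xs) ⟩
  indicator (P? (f x)) + length (filter (P? ∘ f) xs)
    ≡⟨ length-filter-∷ (P? ∘ f) x xs ⟨
  length (filter (P? ∘ f) (x ∷ xs)) ∎
  where open ≡-Reasoning

length-filter-++ : {P : Pred A 0ℓ} (P? : Decidable P) (xs ys : List A) →
  length (filter P? (xs ++ ys)) ≡ length (filter P? xs) + length (filter P? ys)
length-filter-++ P? xs ys = trans (cong length (filter-++ P? xs ys)) (length-++ (filter P? xs))

module _ (ws : List Path) where

  #runs-U∷ : ∀ s k → length (filter (runs≟ s k) (map (U ∷_) ws)) ≡ length (filter (runs≟ U k) ws)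
  #runs-U∷ U k = length-filter-map (runs≟ U k) (U ∷_) ws
  #runs-U∷ D k = length-filter-map (runs≟ D k) (U ∷_) ws

  #runs-D∷ : ∀ k → length (filter (runs≟ D k) (map (D ∷_) ws)) ≡ length (filter (runs≟ D k) ws)
  #runs-D∷ k = length-filter-map (runs≟ D k) (D ∷_) ws

  #runs-U-D∷-suc : ∀ k →
    length (filter (runs≟ U (suc k)) (map (D ∷_) ws)) ≡ length (filter (runs≟ D k) ws)
  #runs-U-D∷-suc k = trans (length-filter-map (runs≟ U (suc k)) (D ∷_) ws)
    (cong length (filter-≐ _ (runs≟ D k) (ℕP.suc-injective , cong suc) ws))

  #runs-U-D∷-zero : length (filter (runs≟ U 0) (map (D ∷_) ws)) ≡ 0
  #runs-U-D∷-zero = trans (length-filter-map (runs≟ U 0) (D ∷_) ws)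
    (cong length (filter-none _ (All.universal (λ _ ()) ws)))

runsCount : Step → ℕ → ℕ → ℕ → ℕ
runsCount s a b k = length (filter (runs≟ s k) (words a b))

runsCount-U-noD : ∀ a k → runsCount U a 0 k ≡ 0 C k
runsCount-U-noD zero zero = refl
runsCount-U-noD zero (suc k) = refl
runsCount-U-noD (suc a) k = trans (#runs-U∷ (words a 0) U k) (runsCount-U-noD a k)

runsCount-U-zero : ∀ a b → runsCount U a (suc b) 0 ≡ 0
runsCount-U-zero zero b = #runs-U-D∷-zero (words 0 b)
runsCount-U-zero (suc a) b =
  trans (length-filter-++ (runs≟ U 0) (map (U ∷_) (words a (suc b))) (map (D ∷_) (words (suc a) b)))
        (cong₂ _+_ (trans (#runs-U∷ (words a (suc b)) U 0) (runsCount-U-zero a b))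
                   (#runs-U-D∷-zero (words (suc a) b)))

runsCount-D-split : ∀ a b k →
  runsCount D (suc a) (suc b) k ≡ runsCount U a (suc b) k + runsCount D (suc a) b k
runsCount-D-split a b k =
  trans (length-filter-++ (runs≟ D k) (map (U ∷_) (words a (suc b))) (map (D ∷_) (words (suc a) b)))
        (cong₂ _+_ (#runs-U∷ (words a (suc b)) D k) (#runs-D∷ (words (suc a) b) k))

runsCount-U-split : ∀ a b k →
  runsCount U (suc a) (suc b) (suc k) ≡ runsCount U a (suc b) (suc k) + runsCount D (suc a) b k
runsCount-U-split a b k =
  trans (length-filter-++ (runs≟ U (suc k)) (map (U ∷_) (words a (suc b))) (map (D ∷_) (words (suc a) b)))
        (cong₂ _+_ (#runs-U∷ (words a (suc b)) U (suc k)) (#runs-U-D∷-suc (words (suc a) b) k))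

runsCount-D : ∀ a b k → runsCount D a b k ≡ (a C k) * (b C k)
runsCount-U : ∀ a b k → runsCount U a (suc b) (suc k) ≡ (suc a C suc k) * (b C k)

runsCount-D zero zero zero = refl
runsCount-D zero zero (suc k) = refl
runsCount-D (suc a) zero zero = trans (#runs-U∷ (words a 0) D 0) (runsCount-U-noD a 0)
runsCount-D (suc a) zero (suc k) =
  trans (#runs-U∷ (words a 0) D (suc k))
        (trans (runsCount-U-noD a (suc k)) (sym (*-zeroʳ (suc a C suc k))))
runsCount-D zero (suc b) zero = trans (#runs-D∷ (words 0 b) 0) (runsCount-D zero b 0)
runsCount-D zero (suc b) (suc k) = trans (#runs-D∷ (words 0 b) (suc k)) (runsCount-D zero b (suc k))
runsCount-D (suc a) (suc b) zero =
  trans (runsCount-D-split a b 0) (cong₂ _+_ (runsCount-U-zero a b) (runsCount-D (suc a) b 0))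
runsCount-D (suc a) (suc b) (suc k) = begin
  runsCount D (suc a) (suc b) (suc k)
    ≡⟨ runsCount-D-split a b (suc k) ⟩
  runsCount U a (suc b) (suc k) + runsCount D (suc a) b (suc k)
    ≡⟨ cong₂ _+_ (runsCount-U a b k) (runsCount-D (suc a) b (suc k)) ⟩
  (suc a C suc k) * (b C k) + (suc a C suc k) * (b C suc k)
    ≡⟨ *-distribˡ-+ (suc a C suc k) (b C k) (b C suc k) ⟨
  (suc a C suc k) * ((b C k) + (b C suc k))
    ≡⟨ cong ((suc a C suc k) *_) (nCk+nC[k+1]≡[n+1]C[k+1] b k) ⟩
  (suc a C suc k) * (suc b C suc k) ∎
  where open ≡-Reasoning

runsCount-U zero b zero = trans (#runs-U-D∷-suc (words 0 b) 0) (runsCount-D zero b 0)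
runsCount-U zero b (suc k) = trans (#runs-U-D∷-suc (words 0 b) (suc k)) (runsCount-D zero b (suc k))
runsCount-U (suc a) b k = begin
  runsCount U (suc a) (suc b) (suc k)
    ≡⟨ runsCount-U-split a b k ⟩
  runsCount U a (suc b) (suc k) + runsCount D (suc a) b k
    ≡⟨ cong₂ _+_ (runsCount-U a b k) (runsCount-D (suc a) b k) ⟩
  (suc a C suc k) * (b C k) + (suc a C k) * (b C k)
    ≡⟨ *-distribʳ-+ (b C k) (suc a C suc k) (suc a C k) ⟨
  ((suc a C suc k) + (suc a C k)) * (b C k)
    ≡⟨ cong (_* (b C k)) (+-comm (suc a C suc k) (suc a C k)) ⟩
  ((suc a C k) + (suc a C suc k)) * (b C k)
    ≡⟨ cong (_* (b C k)) (nCk+nC[k+1]≡[n+1]C[k+1] (suc a) k) ⟩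
  (suc (suc a) C suc k) * (b C k) ∎
  where open ≡-Reasoning

length-filter-runs-P : ∀ n k → length (filter (runs≟ U k) (P n)) ≡ runsCount U n n k
length-filter-runs-P n k =
  length-filter-≡-inverses (runs≟ U k) (runs≟ U k) (P-unique n) (words-unique n n) id id into onto
  where
  into : ∀ {p} → p ∈ P n → descRuns p ≡ k → p ∈ words n n × descRuns p ≡ k × p ≡ p
  into {p} p∈ runs≡k with ∈P⁻ n p∈
  ... | _ , height≡0 =
    subst₂ (λ a b → p ∈ words a b) #U≡n (trans (#D≡#U p height≡0) #U≡n) (∈-words p) , runs≡k , refl
    where #U≡n = ∈P⇒#U≡n n p∈
  onto : ∀ {p} → p ∈ words n n → descRuns p ≡ k → p ∈ P n × descRuns p ≡ k × p ≡ p
  onto {p} p∈ runs≡k with ∈-words⇒#U,#D n n p∈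
  ... | #U≡n , #D≡n = ∈P⁺ n (trans (length≡#U+#D p) (cong₂ _+_ #U≡n #D≡n))
    (#D≡#U⇒heightFrom0≡0 p (trans #D≡n (sym #U≡n))) , runs≡k , refl

theorem7 : (m j i : ℕ) → i ≤ suc m →
  suc (suc m) * count (suc m) (suc j) i ≡ (suc (suc m) C suc j) * (m C j)
theorem7 m j i i≤n = begin
  suc n * count n k i                ≡⟨ cong (suc n *_) (count-uniform n k i≤n) ⟩
  suc n * count n k 0                ≡⟨ ∑≤-const n (count n k 0) ⟨
  ∑≤ n (λ _ → count n k 0)           ≡⟨ ∑≤-cong n (count-uniform n k) ⟨
  ∑≤ n (count n k)                   ≡⟨ ∑≤-count n k ⟩
  length (filter (runs≟ U k) (P n))  ≡⟨ length-filter-runs-P n k ⟩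
  runsCount U n n k                  ≡⟨ runsCount-U n m j ⟩
  (suc n C k) * (m C j)              ∎
  where
  open ≡-Reasoning
  n = suc m
  k = suc j
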